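{- Let $\mathcal P$ be a finite locally geometric poset and $\mathcal Q$ a TM-ideal of $\mathcal P$ with $\operatorname{rk}(\mathcal Q)=\operatorname{rk}(\mathcal P)-1$, and let $a=|A(\mathcal P)\setminus A(\mathcal Q)|$. Then $\chi_{\mathcal P}(t)=\chi_{\mathcal Q}(t)\cdot(t-a)$. In particular, if $\mathcal P$ is strictly supersolvable via a chain of TM-ideals $\{\hat0\}=\mathcal Q_0\subset\mathcal Q_1\subset\cdots\subset\mathcal Q_n=\mathcal P$ (each $\mathcal Q_i$ a TM-ideal of $\mathcal Q_{i+1}$ with $\operatorname{rk}(\mathcal Q_i)=i$) and $a_i=|A(\mathcal Q_i)\setminus A(\mathcal Q_{i-1})|$, then $\chi_{\mathcal P}(t)=\prod_{i=1}^n(t-a_i)$.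
   Context: In a poset, $x\vee y$ is the set of minimal common upper bounds, $\bigvee I$ the set of minimal upper bounds of $I$. A geometric lattice is a chain-finite lattice in which $y$ covers $x$ iff $y=x\vee a$ for an atom $a\not\le x$; an element is modular if its complements form an antichain. A locally geometric poset is graded, bounded below (minimum $\hat0$, rank $\operatorname{rk}$), each $\mathcal P_{\le x}$ a geometric lattice; $A(\mathcal P)$ is its set of atoms, $\operatorname{rk}(\mathcal P)$ its maximal rank. An order ideal $\mathcal Q$ is pure if its maximal elements share rank $\operatorname{rk}(\mathcal Q)$, join-closed if $T\subseteq\mathcal Q\Rightarrow\bigvee T\subseteq\mathcal Q$. A TM-ideal of $\mathcal P$ is a pure join-closed order ideal $\mathcal Q$ such that (TM1) $|a\vee y|=1$ whenever $y\in\mathcal Q$ and $a\in A(\mathcal P)\setminus A(\mathcal Q)$, and (TM2) for every maximal $x\in\mathcal P$ there is a maximal $y\in\mathcal Q$ modular in $\mathcal P_{\le x}$. Characteristic polynomial of a finite graded bounded-below poset $\mathcal P$: $\chi_{\mathcal P}(t)=\sum_{x\in\mathcal P}\mu_{\mathcal P}(x)t^{\operatorname{rk}(\mathcal P)-\operatorname{rk}(x)}$, where $\mu_{\mathcal P}(\hat0)=1$ and $\sum_{y\le x}\mu_{\mathcal P}(y)=0$ for $x\ne\hat0$ (applied to $\mathcal Q$ with its own rank $\operatorname{rk}(\mathcal Q)$). -}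

module Defs where

open import Level using (0ℓ)
open import Data.Nat as ℕ using (ℕ; zero; suc; _∸_; _⊔_)
open import Data.Integer as ℤ using (ℤ; +_; -_; _-_; _*_; _+_; _^_)
open import Data.Fin using (Fin)
open import Data.Fin.Properties using (all?) renaming (_≟_ to _≟F_)
open import Data.Fin.Subset using (Subset; _∈_; _∉_; _⊆_; ⊤; ⁅_⁆)
open import Data.Fin.Subset.Properties using (_∈?_)
open import Data.List as List using (List; allFin; filter; length; foldr)
open import Data.Product using (_×_; ∃; ∃-syntax; _,_)
open import Relation.Binary.Core using (Rel)
open import Relation.Binary.Definitions using (Decidable)
open import Relation.Binary.Structures using (IsPartialOrder)
open import Relation.Binary.PropositionalEquality using (_≡_; _≢_)
open import Relation.Nullary using (¬_; Dec; yes; no; ¬?)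
open import Relation.Nullary.Decidable using (_×-dec_; ⌊_⌋)
open import Data.Bool using (if_then_else_)

record FinPoset : Set₁ where
  field
    card           : ℕ
    _≤_            : Rel (Fin card) 0ℓ
    isPartialOrder : IsPartialOrder _≡_ _≤_
    _≤?_           : Decidable _≤_

module Poset (P : FinPoset) where
  open FinPoset P public

  El : Set
  El = Fin card

  _<_ : El → El → Set
  x < y = x ≤ y × x ≢ y

  _<?_ : Decidable _<_
  x <? y = (x ≤? y) ×-dec ¬? (x ≟F y)

  _⋖_ : El → El → Set
  x ⋖ y = x < y × (∀ z → ¬ (x < z × z < y))

  _⋖?_ : Decidable _⋖_
  x ⋖? y = (x <? y) ×-dec all? (λ z → ¬? ((x <? z) ×-dec (z <? y)))

  -- Relative notions inside an ambient subset S (the poset S with the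
  -- induced order).  For S = ⊤ these are the notions for P itself.

  UB : Subset card → Subset card → El → Set
  UB S T z = z ∈ S × (∀ t → t ∈ T → t ≤ z)

  MinUB : Subset card → Subset card → El → Set
  MinUB S T z = UB S T z × (∀ w → UB S T w → w ≤ z → w ≡ z)

  -- z ∈ a ∨ y computed in S (minimal common upper bound of a and y)
  MinUB₂ : Subset card → El → El → El → Set
  MinUB₂ S a y z = (z ∈ S × a ≤ z × y ≤ z)
                 × (∀ w → w ∈ S → a ≤ w → y ≤ w → w ≤ z → w ≡ z)

  -- |a ∨ y| = 1 in S
  UniqueJoin : Subset card → El → El → Set
  UniqueJoin S a y = ∃[ z ] (MinUB₂ S a y z × (∀ z' → MinUB₂ S a y z' → z' ≡ z))

  MaximalIn : Subset card → El → Set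
  MaximalIn S y = y ∈ S × (∀ w → w ∈ S → y ≤ w → w ≡ y)

  IsOrderIdealIn : Subset card → Subset card → Set
  IsOrderIdealIn S Q = Q ⊆ S × (∀ x y → y ∈ Q → x ≤ y → x ∈ Q)

  IsJoinClosedIn : Subset card → Subset card → Set
  IsJoinClosedIn S Q = ∀ (T : Subset card) → T ⊆ Q → ∀ z → MinUB S T z → z ∈ Q

  IsJoinBelow : El → El → El → El → Set
  IsJoinBelow x y z j = j ≤ x × y ≤ j × z ≤ j
                      × (∀ w → w ≤ x → y ≤ w → z ≤ w → j ≤ w)

  IsMeetBelow : El → El → El → El → Set
  IsMeetBelow x y z m = m ≤ x × m ≤ y × m ≤ z
                      × (∀ w → w ≤ y → w ≤ z → w ≤ m)

record LocallyGeometric (P : FinPoset) : Set where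
  open Poset P
  field
    ⊥̂      : El
    ⊥̂-min  : ∀ x → ⊥̂ ≤ x
    rk     : El → ℕ
    rk-⊥̂   : rk ⊥̂ ≡ 0
    rk-⋖   : ∀ x y → x ⋖ y → rk y ≡ suc (rk x)
    join   : ∀ x y z → y ≤ x → z ≤ x → ∃[ j ] IsJoinBelow x y z j
    meet   : ∀ x y z → y ≤ x → z ≤ x → ∃[ m ] IsMeetBelow x y z m
    -- P_{≤x} is geometric: z ⋖ y  iff  y = z ∨ a for an atom a ≰ z
    geom⇒  : ∀ x y z → y ≤ x → z ≤ x → z ⋖ y →
             ∃[ a ] (a ≤ x × ⊥̂ ⋖ a × ¬ (a ≤ z) × IsJoinBelow x z a y)
    geom⇐  : ∀ x y z a → y ≤ x → z ≤ x → a ≤ x → ⊥̂ ⋖ a → ¬ (a ≤ z) →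
             IsJoinBelow x z a y → z ⋖ y

module LG {P : FinPoset} (G : LocallyGeometric P) where
  open Poset P
  open LocallyGeometric G

  Atom : El → Set
  Atom a = ⊥̂ ⋖ a

  Complement : El → El → El → Set
  Complement x y c = c ≤ x × IsMeetBelow x y c ⊥̂ × IsJoinBelow x y c x

  ModularIn : El → El → Set
  ModularIn x y = y ≤ x ×
    (∀ c c' → Complement x y c → Complement x y c' → c ≤ c' → c ≡ c')

  sumEl : (El → ℤ) → ℤ
  sumEl f = foldr (λ x s → f x + s) (+ 0) (allFin card)

  sumIn : Subset card → (El → ℤ) → ℤ
  sumIn S f = sumEl (λ x → if ⌊ x ∈? S ⌋ then f x else + 0)

  rkOf : Subset card → ℕ
  rkOf S = foldr (λ x m → (if ⌊ x ∈? S ⌋ then rk x else 0) ⊔ m) 0 (allFin card)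

  IsPure : Subset card → Set
  IsPure Q = ∀ y → MaximalIn Q y → rk y ≡ rkOf Q

  record IsTMIdealIn (S Q : Subset card) : Set where
    field
      ideal      : IsOrderIdealIn S Q
      pure       : IsPure Q
      joinClosed : IsJoinClosedIn S Q
      TM1        : ∀ y a → y ∈ Q → a ∈ S → Atom a → a ∉ Q → UniqueJoin S a y
      TM2        : ∀ x → MaximalIn S x → ∃[ y ] (MaximalIn Q y × ModularIn x y)

  IsTMIdeal : Subset card → Set
  IsTMIdeal Q = IsTMIdealIn ⊤ Q

  newAtoms : Subset card → Subset card → ℕ
  newAtoms S Q = length (filter (λ a → (a ∈? S) ×-dec (¬? (a ∈? Q)) ×-dec (⊥̂ ⋖? a))
                                (allFin card))

  μfuel : ℕ → Subset card → El → ℤ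
  μfuel zero    S x = + 0
  μfuel (suc k) S x with x ≟F ⊥̂
  ... | yes _ = + 1
  ... | no  _ = - sumIn S (λ y → if ⌊ y <? x ⌋ then μfuel k S y else + 0)

  μ : Subset card → El → ℤ
  μ S = μfuel card S

  χ : Subset card → ℤ → ℤ
  χ S t = sumIn S (λ x → μ S x * (t ^ (rkOf S ∸ rk x)))

  prodLin : (ℕ → ℕ) → ℕ → ℤ → ℤ
  prodLin a zero    t = + 1
  prodLin a (suc i) t = prodLin a i t * (t - + a (suc i))

-- For x ∈ S ∖ Q let π x be the largest element of Q below x; it exists because Q is
-- join-closed. Using a modular coatom of Q below a maximal element above x (TM2), the
-- rank condition forces π x ⋖ x. By TM1, (x , b) ↦ (b , π x) is then a bijection from
-- pairs (x ∈ S ∖ Q, new atom b ≤ x) to pairs (new atom b, y ∈ Q), with inverse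
-- (b , y) ↦ b ∨ y. Feeding this bijection into the recursion for μ gives, by induction,
-- μ(x) = −#{new atoms ≤ x}·μ(π x); summed over S ∖ Q this contributes −a·χ_Q(t) to χ_S(t),
-- while the elements of Q contribute t·χ_Q(t). Iterating along the chain gives the product.

{-# OPTIONS --safe #-}
module Submission where

open import Level using (Level)
open import Function using (_∘_; flip; _⇔_; mk⇔; Equivalence)
open import Data.Empty using (⊥-elim)
open import Data.Product using (_×_; _,_; proj₁; proj₂; ∃-syntax)
open import Data.Sum using (_⊎_; inj₁; inj₂)
open import Data.Bool using (if_then_else_)
open import Data.Bool.Properties using (T-≡)
open import Data.Nat as ℕ using (ℕ; zero; suc; _⊔_; _∸_)
import Data.Nat.Properties as ℕₚ
open import Data.Nat.Induction using () renaming (<-wellFounded to ℕ-<-wellFounded)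
open import Data.Integer as ℤ using (ℤ; +_; -_; _+_; _*_; _-_; _^_)
import Data.Integer.Properties as ℤ
open import Data.Integer.Tactic.RingSolver using (solve-∀)
open import Data.Fin using (Fin; zero; suc)
open import Data.Fin.Properties using (any?; all?; suc-injective) renaming (_≟_ to _≟F_)
open import Data.Fin.Subset using (Subset; _∈_; _∉_; _⊆_; _⊂_; ∣_∣; ⊤; ⁅_⁆)
open import Data.Fin.Subset.Properties using (_∈?_; ∈⊤; x∈⁅x⁆; x∈⁅y⁆⇒x≡y; p⊂q⇒∣p∣<∣q∣; ∣⊤∣≡n)
open import Data.Fin.Subset.Induction using (⊃-wellFounded)
import Data.Vec as Vec
open import Data.Vec.Properties using (lookup∘tabulate; lookup⇒[]=; []=⇒lookup)
open import Data.List using (List; _∷_; []; filter; length; foldr; tabulate; allFin)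
open import Data.List.Relation.Unary.Any using (here; there)
open import Data.List.Membership.Propositional using () renaming (_∈_ to _∈ₗ_)
open import Data.List.Membership.Propositional.Properties using (∈-allFin)
open import Relation.Binary.PropositionalEquality
  using (_≡_; _≢_; refl; sym; trans; cong; cong₂; subst; module ≡-Reasoning)
open import Relation.Binary.Structures using (IsPartialOrder)
import Relation.Binary.Construct.On as On
open import Relation.Nullary using (¬_; Dec; yes; no)
open import Relation.Nullary.Decidable using (⌊_⌋; _×-dec_; _→-dec_; ¬?; toWitness; fromWitness)
import Relation.Unary as U
open import Induction.WellFounded using (WellFounded; Acc; acc; module Subrelation)
open import Algebra.Properties.Semiring.Sum ℤ.+-*-semiring
  using (sum; ∑-comm; ∑-distrib-+; *-distribˡ-sum; *-distribʳ-sum; sum-cong-≗; sum-replicate-zero)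

open import Defs

private
  variable
    ℓ : Level
    A B C : Set ℓ

-- Iverson bracket, written exactly like the guards in Defs so that sumIn and μfuel unfold to it.
infixr 9 ⟦_⟧_

⟦_⟧_ : Dec A → ℤ → ℤ
⟦ d ⟧ v = if ⌊ d ⌋ then v else + 0

module _ {n : ℕ} where

  sum-zero : {f : Fin n → ℤ} → (∀ i → f i ≡ + 0) → sum f ≡ + 0
  sum-zero f≡0 = trans (sum-cong-≗ f≡0) (sum-replicate-zero n)

  sum-neg : (f : Fin n → ℤ) → sum (λ i → - f i) ≡ - sum f
  sum-neg f = begin
    sum (λ i → - f i)        ≡⟨ sum-cong-≗ (λ i → sym (ℤ.-1*i≡-i (f i))) ⟩
    sum (λ i → ℤ.-1ℤ * f i) ≡⟨ *-distribˡ-sum ℤ.-1ℤ f ⟨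
    ℤ.-1ℤ * sum f            ≡⟨ ℤ.-1*i≡-i (sum f) ⟩
    - sum f                  ∎
    where open ≡-Reasoning

  sum-*ʳ : (f : Fin n → ℤ) (c : ℤ) → sum (λ i → f i * c) ≡ sum f * c
  sum-*ʳ f c = sym (*-distribʳ-sum c f)

sum-single : ∀ {n} (f : Fin n → ℤ) (i₀ : Fin n) → (∀ i → i ≢ i₀ → f i ≡ + 0) → sum f ≡ f i₀
sum-single {suc n} f zero     f≡0 = trans (cong (λ s → f zero + s) (sum-zero (λ i → f≡0 (suc i) λ ()))) (ℤ.+-identityʳ _)
sum-single {suc n} f (suc i₀) f≡0 = trans (cong (_+ sum (f ∘ suc)) (f≡0 zero λ ()))
  (trans (ℤ.+-identityˡ _) (sum-single (f ∘ suc) i₀ λ i i≢i₀ → f≡0 (suc i) (i≢i₀ ∘ suc-injective)))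

⟦⟧-yes : (d : Dec A) {v : ℤ} → A → ⟦ d ⟧ v ≡ v
⟦⟧-yes (yes _) _  = refl
⟦⟧-yes (no ¬a) a = ⊥-elim (¬a a)

⟦⟧-no : (d : Dec A) {v : ℤ} → ¬ A → ⟦ d ⟧ v ≡ + 0
⟦⟧-no (yes a) ¬a = ⊥-elim (¬a a)
⟦⟧-no (no _)  _  = refl

⟦⟧-cong : (d : Dec A) {v w : ℤ} → (A → v ≡ w) → ⟦ d ⟧ v ≡ ⟦ d ⟧ w
⟦⟧-cong (yes a) v≡w = v≡w a
⟦⟧-cong (no _)  _   = refl

⟦⟧-zero : (d : Dec A) → ⟦ d ⟧ (+ 0) ≡ + 0
⟦⟧-zero (yes _) = refl
⟦⟧-zero (no _)  = refl

⟦⟧-neg : (d : Dec A) (v : ℤ) → ⟦ d ⟧ (- v) ≡ - ⟦ d ⟧ v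
⟦⟧-neg (yes _) v = refl
⟦⟧-neg (no _)  v = refl

⟦⟧-*ʳ : (d : Dec A) (v w : ℤ) → (⟦ d ⟧ v) * w ≡ ⟦ d ⟧ (v * w)
⟦⟧-*ʳ (yes _) v w = refl
⟦⟧-*ʳ (no _)  v w = refl

⟦⟧-sum : (d : Dec A) {n : ℕ} (f : Fin n → ℤ) → ⟦ d ⟧ sum f ≡ sum (λ i → ⟦ d ⟧ f i)
⟦⟧-sum (yes _) f = refl
⟦⟧-sum (no _) {n} f = sym (sum-zero {n} (λ _ → refl))

⟦⟧-⇔ : (d : Dec A) (e : Dec B) {v : ℤ} → A ⇔ B → ⟦ d ⟧ v ≡ ⟦ e ⟧ v
⟦⟧-⇔ (yes _) (yes _) _   = refl
⟦⟧-⇔ (yes a) (no ¬b) A⇔B = ⊥-elim (¬b (Equivalence.to A⇔B a))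
⟦⟧-⇔ (no ¬a) (yes b) A⇔B = ⊥-elim (¬a (Equivalence.from A⇔B b))
⟦⟧-⇔ (no _)  (no _)  _   = refl

⟦⟧-× : (d : Dec A) (e : Dec B) (v : ℤ) → ⟦ d ⟧ ⟦ e ⟧ v ≡ ⟦ d ×-dec e ⟧ v
⟦⟧-× (yes _) (yes _) v = refl
⟦⟧-× (yes _) (no _)  v = refl
⟦⟧-× (no _)  _       v = refl

⟦⟧-⊎ : (d : Dec A) (e : Dec B) (f : Dec C) {v : ℤ} →
       (A → B ⊎ C) → (B ⊎ C → A) → (B → ¬ C) → ⟦ d ⟧ v ≡ ⟦ e ⟧ v + ⟦ f ⟧ v
⟦⟧-⊎ (no ¬a) e f to from disj = sym (cong₂ _+_ (⟦⟧-no e (¬a ∘ from ∘ inj₁)) (⟦⟧-no f (¬a ∘ from ∘ inj₂)))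
⟦⟧-⊎ (yes a) e f to from disj with to a
... | inj₁ b = sym (trans (cong₂ _+_ (⟦⟧-yes e b) (⟦⟧-no f (disj b))) (ℤ.+-identityʳ _))
... | inj₂ c = sym (trans (cong₂ _+_ (⟦⟧-no e (λ b → disj b c)) (⟦⟧-yes f c)) (ℤ.+-identityˡ _))

sum-⟦⟧-unique : ∀ {n p} {P : Fin n → Set p} (P? : U.Decidable P) (f : Fin n → ℤ) {i₀ : Fin n} →
                P i₀ → (∀ i → P i → i ≡ i₀) → sum (λ i → ⟦ P? i ⟧ f i) ≡ f i₀
sum-⟦⟧-unique P? f {i₀} Pi₀ unique =
  trans (sum-single _ i₀ (λ i i≢i₀ → ⟦⟧-no (P? i) (i≢i₀ ∘ unique i))) (⟦⟧-yes (P? i₀) Pi₀)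

sum-⟦⟧-const : ∀ {n p} {P : Fin n → Set p} (P? : U.Decidable P) (v : ℤ) →
                sum (λ i → ⟦ P? i ⟧ v) ≡ sum (λ i → ⟦ P? i ⟧ (+ 1)) * v
sum-⟦⟧-const P? v = trans (sum-cong-≗ λ i → trans (cong (⟦ P? i ⟧_) (sym (ℤ.*-identityˡ v))) (sym (⟦⟧-*ʳ (P? i) (+ 1) v)))
                          (sum-*ʳ (λ i → ⟦ P? i ⟧ (+ 1)) v)

sum-foldr-tabulate : ∀ {n} (g : Fin n → A) (f : A → ℤ) →
                     foldr (λ x s → f x + s) (+ 0) (tabulate g) ≡ sum (f ∘ g)
sum-foldr-tabulate {n = zero}  g f = refl
sum-foldr-tabulate {n = suc n} g f = cong (λ s → f (g zero) + s) (sum-foldr-tabulate (g ∘ suc) f)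

length-filter-tabulate : ∀ {p} {P : A → Set p} (P? : U.Decidable P) {n} (g : Fin n → A) →
                         + length (filter P? (tabulate g)) ≡ sum (λ i → ⟦ P? (g i) ⟧ (+ 1))
length-filter-tabulate P? {zero}  g = refl
length-filter-tabulate P? {suc n} g with P? (g zero)
... | yes _ = trans (ℤ.pos-+ 1 _) (cong (λ s → + 1 + s) (length-filter-tabulate P? (g ∘ suc)))
... | no _  = trans (length-filter-tabulate P? (g ∘ suc)) (sym (ℤ.+-identityˡ _))

subsetOf : ∀ {n p} {P : Fin n → Set p} → U.Decidable P → Subset n
subsetOf P? = Vec.tabulate (λ i → ⌊ P? i ⌋)

module _ {n p} {P : Fin n → Set p} (P? : U.Decidable P) {i : Fin n} where

  ∈-subsetOf⁺ : P i → i ∈ subsetOf P?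
  ∈-subsetOf⁺ Pi = lookup⇒[]= i _ (trans (lookup∘tabulate _ i) (Equivalence.to T-≡ (fromWitness Pi)))

  ∈-subsetOf⁻ : i ∈ subsetOf P? → P i
  ∈-subsetOf⁻ i∈ = toWitness (Equivalence.from T-≡ (trans (sym (lookup∘tabulate _ i)) ([]=⇒lookup i∈)))

module FinPosetProperties (P : FinPoset) where
  open Poset P
  open IsPartialOrder isPartialOrder public
    using (antisym) renaming (refl to ≤-refl; reflexive to ≤-reflexive; trans to ≤-trans)

  private
    variable
      x y z : El

  IsDownClosed : Subset card → Set
  IsDownClosed S = ∀ x y → y ∈ S → x ≤ y → x ∈ S

  <-irrefl : ¬ x < x
  <-irrefl (_ , x≢x) = x≢x refl

  ≤-<-trans : x ≤ y → y < z → x < z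
  ≤-<-trans x≤y (y≤z , y≢z) = ≤-trans x≤y y≤z , λ { refl → y≢z (antisym y≤z x≤y) }

  <-≤-trans : x < y → y ≤ z → x < z
  <-≤-trans (x≤y , x≢y) y≤z = ≤-trans x≤y y≤z , λ { refl → x≢y (antisym x≤y y≤z) }

  <-trans : x < y → y < z → x < z
  <-trans x<y (y≤z , _) = <-≤-trans x<y y≤z

  ⋖-≤-≡ : ∀ {x y z} → y ⋖ x → y < z → z ≤ x → z ≡ x
  ⋖-≤-≡ {x} {z = z} (_ , nothing-between) y<z z≤x with z ≟F x
  ... | yes z≡x = z≡x
  ... | no  z≢x = ⊥-elim (nothing-between z (y<z , z≤x , z≢x))

  ↓_ : El → Subset card
  ↓ x = subsetOf (_<? x)

  ↓-mono-< : ∀ {x y} → y < x → ↓ y ⊂ ↓ x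
  ↓-mono-< {y = y} y<x = (λ z∈↓y → ∈-subsetOf⁺ _ (<-trans (∈-subsetOf⁻ _ z∈↓y) y<x))
                   , y , ∈-subsetOf⁺ _ y<x , <-irrefl ∘ ∈-subsetOf⁻ _

  height : El → ℕ
  height x = ∣ ↓ x ∣

  height-mono-< : y < x → height y ℕ.< height x
  height-mono-< = p⊂q⇒∣p∣<∣q∣ ∘ ↓-mono-<

  height<card : ∀ x → height x ℕ.< card
  height<card x = subst (height x ℕ.<_) (∣⊤∣≡n card)
    (p⊂q⇒∣p∣<∣q∣ ((λ _ → ∈⊤) , x , ∈⊤ , <-irrefl ∘ ∈-subsetOf⁻ _))

  <-wellFounded : WellFounded _<_
  <-wellFounded = Subrelation.wellFounded height-mono-< (On.wellFounded height ℕ-<-wellFounded)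

  >-wellFounded : WellFounded (flip _<_)
  >-wellFounded = Subrelation.wellFounded ↓-mono-< (On.wellFounded ↓_ ⊃-wellFounded)

  <⇒∃⋖ : y < x → ∃[ u ] (y ⋖ u × u ≤ x)
  <⇒∃⋖ = go (<-wellFounded _)
    where
    go : Acc _<_ x → y < x → ∃[ u ] (y ⋖ u × u ≤ x)
    go {x} {y} (acc below) y<x with any? (λ z → (y <? z) ×-dec (z <? x))
    ... | yes (z , y<z , z<x) = let u , y⋖u , u≤z = go (below z<x) y<z in u , y⋖u , ≤-trans u≤z (proj₁ z<x)
    ... | no  ∄z = x , (y<x , λ z y<z<x → ∄z (z , y<z<x)) , ≤-refl

  ∃-maximal-above : (S : Subset card) → x ∈ S → ∃[ m ] (MaximalIn S m × x ≤ m)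
  ∃-maximal-above S = go (>-wellFounded _)
    where
    go : Acc (flip _<_) x → x ∈ S → ∃[ m ] (MaximalIn S m × x ≤ m)
    go {x} (acc above) x∈S with any? (λ w → (w ∈? S) ×-dec (x <? w))
    ... | yes (w , w∈S , x<w) = let m , m-max , w≤m = go (above x<w) w∈S in m , m-max , ≤-trans (proj₁ x<w) w≤m
    ... | no  ∄w = x , (x∈S , maximal) , ≤-refl
      where
      maximal : ∀ w → w ∈ S → x ≤ w → w ≡ x
      maximal w w∈S x≤w with w ≟F x
      ... | yes w≡x = w≡x
      ... | no  w≢x = ⊥-elim (∄w (w , w∈S , x≤w , w≢x ∘ sym))

module LocallyGeometricProperties {P : FinPoset} (G : LocallyGeometric P) where
  open Poset P
  open LocallyGeometric G
  open LG G
  open FinPosetProperties P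

  private
    variable
      x y u : El

  sumEl≡sum : (f : El → ℤ) → sumEl f ≡ sum f
  sumEl≡sum = sum-foldr-tabulate (λ x → x)

  rk-mono-< : y < x → rk y ℕ.< rk x
  rk-mono-< = go (>-wellFounded _)
    where
    go : Acc (flip _<_) y → y < x → rk y ℕ.< rk x
    go {y} {x} (acc above) y<x with <⇒∃⋖ y<x
    ... | u , y⋖u , u≤x with u ≟F x
    ...   | yes refl = ℕₚ.≤-reflexive (sym (rk-⋖ y u y⋖u))
    ...   | no  u≢x  = ℕₚ.<-trans (ℕₚ.≤-reflexive (sym (rk-⋖ y u y⋖u))) (go (above (proj₁ y⋖u)) (u≤x , u≢x))

  ⊥̂< : x ≢ ⊥̂ → ⊥̂ < x
  ⊥̂< x≢⊥̂ = ⊥̂-min _ , x≢⊥̂ ∘ sym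

  atom-≤-≡ : Atom x → Atom y → x ≤ y → x ≡ y
  atom-≤-≡ x-atom y-atom x≤y = ⋖-≤-≡ y-atom (proj₁ x-atom) x≤y

  ∃-atom-≤-≰ : u < x → ∃[ b ] (Atom b × b ≤ x × ¬ b ≤ u)
  ∃-atom-≤-≰ {u} {x} u<x with <⇒∃⋖ u<x
  ... | v , u⋖v , v≤x with geom⇒ x v u v≤x (proj₁ u<x) u⋖v
  ...   | b , b≤x , b-atom , b≰u , _ = b , b-atom , b≤x , b≰u

  coatom-complement : ∀ {m c} → y ⋖ m → c ≤ m → ¬ c ≤ y → (∀ w → w ≤ y → w ≤ c → w ≤ ⊥̂) → Complement m y c
  coatom-complement {y} {m} {c} y⋖m@((y≤m , _) , _) c≤m c≰y disjoint =
    c≤m , (⊥̂-min m , ⊥̂-min y , ⊥̂-min c , disjoint) , (≤-refl , y≤m , c≤m , join-is-m)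
    where
    join-is-m : ∀ w → w ≤ m → y ≤ w → c ≤ w → m ≤ w
    join-is-m w w≤m y≤w c≤w = ≤-reflexive (sym (⋖-≤-≡ y⋖m (y≤w , λ { refl → c≰y c≤w }) w≤m))

  IsUpperBoundBelow : El → Subset card → El → Set
  IsUpperBoundBelow x T w = w ≤ x × (∀ z → z ∈ T → z ≤ x → z ≤ w)

  supBelow : ∀ x (T : Subset card) →
             ∃[ j ] (IsUpperBoundBelow x T j × (∀ w → IsUpperBoundBelow x T w → j ≤ w))
  supBelow x T =
    let j , (j≤x , ub) , least = go (allFin card)
    in  j , (j≤x , λ z → ub z (∈-allFin z)) , λ w (w≤x , ubw) → least w w≤x (λ z _ → ubw z)
    where
    Bounds : List El → El → Set
    Bounds l w = ∀ z → z ∈ₗ l → z ∈ T → z ≤ x → z ≤ w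

    go : ∀ l → ∃[ j ] ((j ≤ x × Bounds l j) × (∀ w → w ≤ x → Bounds l w → j ≤ w))
    go []      = ⊥̂ , (⊥̂-min x , λ _ ()) , λ w _ _ → ⊥̂-min w
    go (z ∷ l) with go l | (z ∈? T) ×-dec (z ≤? x)
    ... | j , (j≤x , ub) , least | no z∉T∩↓x =
      j , (j≤x , λ { _ (here refl) z∈T z≤x → ⊥-elim (z∉T∩↓x (z∈T , z≤x)) ; z′ (there z′∈l) → ub z′ z′∈l })
        , λ w w≤x ubw → least w w≤x (λ z′ → ubw z′ ∘ there)
    ... | j , (j≤x , ub) , least | yes (z∈T , z≤x) with join x j z j≤x z≤x
    ...   | k , k≤x , j≤k , z≤k , k-least =
      k , (k≤x , λ { _ (here refl) _ _ → z≤k ; z′ (there z′∈l) z′∈T z′≤x → ≤-trans (ub z′ z′∈l z′∈T z′≤x) j≤k })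
        , λ w w≤x ubw → k-least w w≤x (least w w≤x (λ z′ → ubw z′ ∘ there)) (ubw z (here refl) z∈T z≤x)

  rk≤rkOf : ∀ {S} → x ∈ S → rk x ℕ.≤ rkOf S
  rk≤rkOf {x} {S} x∈S = go (∈-allFin x)
    where
    go : ∀ {l} → x ∈ₗ l → rk x ℕ.≤ foldr (λ z m → (if ⌊ z ∈? S ⌋ then rk z else 0) ⊔ m) 0 l
    go {l = _ ∷ _} (here refl) with x ∈? S
    ... | yes _   = ℕₚ.m≤m⊔n _ _
    ... | no  x∉S = ⊥-elim (x∉S x∈S)
    go {l = z ∷ _} (there x∈l) = ℕₚ.≤-trans (go x∈l) (ℕₚ.m≤n⊔m (if ⌊ z ∈? S ⌋ then rk z else 0) _)

  sumIn-cong : ∀ S {f g : El → ℤ} → (∀ x → f x ≡ g x) → sumIn S f ≡ sumIn S g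
  sumIn-cong S {f} {g} f≗g = begin
    sumIn S f                      ≡⟨ sumEl≡sum _ ⟩
    sum (λ x → ⟦ x ∈? S ⟧ f x)     ≡⟨ sum-cong-≗ (λ x → ⟦⟧-cong (x ∈? S) (λ _ → f≗g x)) ⟩
    sum (λ x → ⟦ x ∈? S ⟧ g x)     ≡⟨ sumEl≡sum _ ⟨
    sumIn S g                      ∎
    where open ≡-Reasoning

  -- Any fuel exceeding the height of x computes the same value as the fuel card used by μ.
  μfuel-stable : ∀ S {k k′} x → height x ℕ.< k → height x ℕ.< k′ → μfuel k S x ≡ μfuel k′ S x
  μfuel-stable S {suc k} {suc k′} x hx<k hx<k′ with x ≟F ⊥̂
  ... | yes _ = refl
  ... | no  _ = cong -_ (sumIn-cong S λ y → ⟦⟧-cong (y <? x) λ y<x →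
      μfuel-stable S y (ℕₚ.<-≤-trans (height-mono-< y<x) (ℕₚ.≤-pred hx<k))
                       (ℕₚ.<-≤-trans (height-mono-< y<x) (ℕₚ.≤-pred hx<k′)))

  μ-⊥̂ : ∀ S → μ S ⊥̂ ≡ + 1
  μ-⊥̂ S = trans (μfuel-stable S ⊥̂ (height<card ⊥̂) (ℕₚ.n<1+n _)) unfold
    where
    unfold : μfuel (suc (height ⊥̂)) S ⊥̂ ≡ + 1
    unfold with ⊥̂ ≟F ⊥̂
    ... | yes _    = refl
    ... | no  ⊥̂≢⊥̂ = ⊥-elim (⊥̂≢⊥̂ refl)

  μ-recurrence : ∀ S → x ≢ ⊥̂ → μ S x ≡ - sum (λ y → ⟦ y ∈? S ⟧ ⟦ y <? x ⟧ μ S y)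
  μ-recurrence {x} S x≢⊥̂ = trans (μfuel-stable S x (height<card x) (ℕₚ.n<1+n _)) unfold
    where
    unfold : μfuel (suc (height x)) S x ≡ - sum (λ y → ⟦ y ∈? S ⟧ ⟦ y <? x ⟧ μ S y)
    unfold with x ≟F ⊥̂
    ... | yes x≡⊥̂ = ⊥-elim (x≢⊥̂ x≡⊥̂)
    ... | no  _   = cong -_ (trans (sumIn-cong S λ y → ⟦⟧-cong (y <? x) λ y<x →
                      μfuel-stable S y (height-mono-< y<x) (height<card y)) (sumEl≡sum _))

  μ-ideal : ∀ {S Q} → Q ⊆ S → IsDownClosed Q → x ∈ Q → μ S x ≡ μ Q x
  μ-ideal {S = S} {Q} Q⊆S Q-down = go card _
    where
    go : ∀ k x → x ∈ Q → μfuel k S x ≡ μfuel k Q x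
    go zero    x x∈Q = refl
    go (suc k) x x∈Q with x ≟F ⊥̂
    ... | yes _ = refl
    ... | no  _ = cong -_ (trans (sumEl≡sum _) (trans (sum-cong-≗ same-terms) (sym (sumEl≡sum _))))
      where
      same-terms : ∀ y → ⟦ y ∈? S ⟧ ⟦ y <? x ⟧ μfuel k S y ≡ ⟦ y ∈? Q ⟧ ⟦ y <? x ⟧ μfuel k Q y
      same-terms y with y <? x
      ... | no  _   = trans (⟦⟧-zero (y ∈? S)) (sym (⟦⟧-zero (y ∈? Q)))
      ... | yes y<x = let y∈Q = Q-down y x x∈Q (proj₁ y<x) in
        trans (⟦⟧-yes (y ∈? S) (Q⊆S y∈Q)) (trans (go k y y∈Q) (sym (⟦⟧-yes (y ∈? Q) y∈Q)))

  μ-recurrence-down : ∀ {S} → IsDownClosed S → x ∈ S → x ≢ ⊥̂ → μ S x ≡ - sum (λ y → ⟦ y <? x ⟧ μ S y)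
  μ-recurrence-down {x} {S} S-down x∈S x≢⊥̂ = trans (μ-recurrence S x≢⊥̂) (cong -_ (sum-cong-≗ drop-∈S))
    where
    drop-∈S : ∀ y → ⟦ y ∈? S ⟧ ⟦ y <? x ⟧ μ S y ≡ ⟦ y <? x ⟧ μ S y
    drop-∈S y = trans (⟦⟧-× (y ∈? S) (y <? x) (μ S y))
      (⟦⟧-⇔ ((y ∈? S) ×-dec (y <? x)) (y <? x) (mk⇔ proj₂ λ y<x → S-down y x x∈S (proj₁ y<x) , y<x))

  sum-≤-split : ∀ (f : El → ℤ) y → sum (λ z → ⟦ z ≤? y ⟧ f z) ≡ sum (λ z → ⟦ z <? y ⟧ f z) + f y
  sum-≤-split f y = trans (sum-cong-≗ split) (trans (∑-distrib-+ (λ z → ⟦ z <? y ⟧ f z) (λ z → ⟦ z ≟F y ⟧ f z))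
    (cong (λ s → sum (λ z → ⟦ z <? y ⟧ f z) + s) (sum-⟦⟧-unique (_≟F y) f refl (λ _ z≡y → z≡y))))
    where
    split : ∀ z → ⟦ z ≤? y ⟧ f z ≡ ⟦ z <? y ⟧ f z + ⟦ z ≟F y ⟧ f z
    split z = ⟦⟧-⊎ (z ≤? y) (z <? y) (z ≟F y) to from (λ (_ , z≢y) → z≢y)
      where
      to : z ≤ y → z < y ⊎ z ≡ y
      to z≤y with z ≟F y
      ... | yes z≡y = inj₂ z≡y
      ... | no  z≢y = inj₁ (z≤y , z≢y)
      from : z < y ⊎ z ≡ y → z ≤ y
      from (inj₁ z<y) = proj₁ z<y
      from (inj₂ z≡y) = ≤-reflexive z≡y

  χ-⁅⊥̂⁆ : ∀ t → χ ⁅ ⊥̂ ⁆ t ≡ t ^ rkOf ⁅ ⊥̂ ⁆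
  χ-⁅⊥̂⁆ t = begin
    χ ⁅ ⊥̂ ⁆ t
      ≡⟨ sumEl≡sum _ ⟩
    sum (λ x → ⟦ x ∈? ⁅ ⊥̂ ⁆ ⟧ (μ ⁅ ⊥̂ ⁆ x * t ^ (rkOf ⁅ ⊥̂ ⁆ ∸ rk x)))
      ≡⟨ sum-⟦⟧-unique (_∈? ⁅ ⊥̂ ⁆) (λ x → μ ⁅ ⊥̂ ⁆ x * t ^ (rkOf ⁅ ⊥̂ ⁆ ∸ rk x)) (x∈⁅x⁆ ⊥̂) (λ _ → x∈⁅y⁆⇒x≡y ⊥̂) ⟩
    μ ⁅ ⊥̂ ⁆ ⊥̂ * t ^ (rkOf ⁅ ⊥̂ ⁆ ∸ rk ⊥̂)
      ≡⟨ cong₂ (λ m e → m * t ^ (rkOf ⁅ ⊥̂ ⁆ ∸ e)) (μ-⊥̂ ⁅ ⊥̂ ⁆) rk-⊥̂ ⟩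
    + 1 * t ^ rkOf ⁅ ⊥̂ ⁆
      ≡⟨ ℤ.*-identityˡ _ ⟩
    t ^ rkOf ⁅ ⊥̂ ⁆ ∎
    where open ≡-Reasoning

module TMIdealProperties
  {P : FinPoset} (G : LocallyGeometric P) (S Q : Subset (FinPoset.card P))
  (S-down : FinPosetProperties.IsDownClosed P S) (tm : LG.IsTMIdealIn G S Q)
  (rk-step : suc (LG.rkOf G Q) ≡ LG.rkOf G S)
  where
  open Poset P
  open LocallyGeometric G
  open LG G
  open FinPosetProperties P
  open LocallyGeometricProperties G
  open IsTMIdealIn tm

  private
    variable
      b x y z w : El

  Q⊆S : Q ⊆ S
  Q⊆S = proj₁ ideal

  Q-down : IsDownClosed Q
  Q-down = proj₂ ideal

  Outer : El → Set
  Outer x = x ∈ S × x ∉ Q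

  Outer? : U.Decidable Outer
  Outer? x = (x ∈? S) ×-dec ¬? (x ∈? Q)

  NewAtom : El → Set
  NewAtom b = b ∈ S × b ∉ Q × Atom b

  NewAtom? : U.Decidable NewAtom
  NewAtom? b = (b ∈? S) ×-dec ¬? (b ∈? Q) ×-dec (⊥̂ ⋖? b)

  π : El → El
  π x = proj₁ (supBelow x Q)

  π-≤ : π x ≤ x
  π-≤ {x} = proj₁ (proj₁ (proj₂ (supBelow x Q)))

  π-greatest : z ∈ Q → z ≤ x → z ≤ π x
  π-greatest {z} {x} z∈Q = proj₂ (proj₁ (proj₂ (supBelow x Q))) z z∈Q

  π-∈ : x ∈ S → π x ∈ Q
  π-∈ {x} x∈S = joinClosed T (proj₁ ∘ ∈-subsetOf⁻ T?) (π x) (upper-bound , minimal)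
    where
    T? : U.Decidable (λ z → z ∈ Q × z ≤ x)
    T? z = (z ∈? Q) ×-dec (z ≤? x)
    T : Subset card
    T = subsetOf T?
    upper-bound : UB S T (π x)
    upper-bound = S-down _ x x∈S π-≤ , λ z z∈T → let z∈Q , z≤x = ∈-subsetOf⁻ T? z∈T in π-greatest z∈Q z≤x
    minimal : ∀ w → UB S T w → w ≤ π x → w ≡ π x
    minimal w (_ , w-ub) w≤π = antisym w≤π (proj₂ (proj₂ (supBelow x Q)) w
      (≤-trans w≤π π-≤ , λ z z∈Q z≤x → w-ub z (∈-subsetOf⁺ T? (z∈Q , z≤x))))

  π-mono : x ∈ S → z ≤ x → π z ≤ π x
  π-mono x∈S z≤x = π-greatest (π-∈ (S-down _ _ x∈S z≤x)) (≤-trans π-≤ z≤x)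

  π< : Outer x → π x < x
  π< (x∈S , x∉Q) = π-≤ , λ π≡x → x∉Q (subst (_∈ Q) π≡x (π-∈ x∈S))

  modular-coatom-above : Outer x → ∃[ m ] ∃[ h ] (x ≤ m × h ∈ Q × h ⋖ m × ModularIn m h)
  modular-coatom-above {x} (x∈S , x∉Q) with ∃-maximal-above S x∈S
  ... | m , m-max , x≤m with TM2 m m-max
  ...   | h , h-max@(h∈Q , _) , h-mod@(h≤m , _) = m , h , x≤m , h∈Q , (h<m , nothing-between) , h-mod
    where
    h<m : h < m
    h<m = h≤m , λ { refl → x∉Q (Q-down x h h∈Q x≤m) }
    nothing-between : ∀ u → ¬ (h < u × u < m)
    nothing-between u (h<u , u<m) = ℕₚ.<⇒≱ (ℕₚ.≤-<-trans (rk-mono-< h<u) (rk-mono-< u<m)) (begin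
      rk m          ≤⟨ rk≤rkOf (proj₁ m-max) ⟩
      rkOf S        ≡⟨ rk-step ⟨
      suc (rkOf Q)  ≡⟨ cong suc (pure h h-max) ⟨
      suc (rk h)    ∎)
      where open ℕₚ.≤-Reasoning

  -- Atoms b₁ ≤ u with b₁ ≰ π x and b₂ ≤ x with b₂ ≰ u would make b₁ < b₁ ∨ b₂ two comparable
  -- complements of the modular coatom h.
  π-no-gap : ∀ {u} → Outer x → π x ⋖ u → ¬ u < x
  π-no-gap {x} {u} x-outer πx⋖u u<x
    with ∃-atom-≤-≰ (proj₁ πx⋖u) | ∃-atom-≤-≰ u<x | modular-coatom-above x-outer
  ... | b₁ , b₁-atom , b₁≤u , b₁≰πx | b₂ , b₂-atom , b₂≤x , b₂≰u | m , h , x≤m , h∈Q , h⋖m , (_ , antichain)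
    with join x b₁ b₂ (≤-trans b₁≤u (proj₁ u<x)) b₂≤x
  ... | d , d≤x , b₁≤d , b₂≤d , d-least = b₂≰b₁ (subst (b₂ ≤_) (sym b₁≡d) b₂≤d)
    where
    b₁≤x : b₁ ≤ x
    b₁≤x = ≤-trans b₁≤u (proj₁ u<x)

    b₂≰b₁ : ¬ b₂ ≤ b₁
    b₂≰b₁ b₂≤b₁ = b₂≰u (≤-trans b₂≤b₁ b₁≤u)

    b₁⋖d : b₁ ⋖ d
    b₁⋖d = geom⇐ x d b₁ b₂ d≤x b₁≤x b₂≤x b₂-atom b₂≰b₁ (d≤x , b₁≤d , b₂≤d , d-least)

    b₁≰h : ¬ b₁ ≤ h
    b₁≰h b₁≤h = b₁≰πx (π-greatest (Q-down _ _ h∈Q b₁≤h) b₁≤x)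

    disjoint : ∀ w → w ≤ h → w ≤ d → w ≤ ⊥̂
    disjoint w w≤h w≤d with w ≟F ⊥̂
    ... | yes w≡⊥̂ = ≤-reflexive w≡⊥̂
    ... | no  w≢⊥̂ with ∃-atom-≤-≰ (⊥̂< w≢⊥̂)
    ...   | e , e-atom , e≤w , _ with join x b₁ e b₁≤x (≤-trans e≤w (≤-trans w≤d d≤x))
    ...     | f , f≤x , b₁≤f , e≤f , f-least = ⊥-elim (b₂≰u (≤-trans b₂≤d (subst (_≤ u) f≡d f≤u)))
      where
      e≤πx : e ≤ π x
      e≤πx = π-greatest (Q-down _ _ h∈Q (≤-trans e≤w w≤h)) (≤-trans e≤w (≤-trans w≤d d≤x))
      b₁<f : b₁ < f
      b₁<f = b₁≤f , λ { refl → b₁≰πx (subst (_≤ π x) (atom-≤-≡ e-atom b₁-atom e≤f) e≤πx) }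
      f≡d : f ≡ d
      f≡d = ⋖-≤-≡ b₁⋖d b₁<f (f-least d d≤x b₁≤d (≤-trans e≤w w≤d))
      f≤u : f ≤ u
      f≤u = f-least u (proj₁ u<x) b₁≤u (≤-trans e≤πx (proj₁ (proj₁ πx⋖u)))

    complement : ∀ {d′} → b₁ ≤ d′ → d′ ≤ d → Complement m h d′
    complement b₁≤d′ d′≤d = coatom-complement h⋖m (≤-trans d′≤d (≤-trans d≤x x≤m))
      (λ d′≤h → b₁≰h (≤-trans b₁≤d′ d′≤h)) (λ w w≤h w≤d′ → disjoint w w≤h (≤-trans w≤d′ d′≤d))

    b₁≡d : b₁ ≡ d
    b₁≡d = antichain b₁ d (complement ≤-refl b₁≤d) (complement b₁≤d ≤-refl) b₁≤d

  π-⋖ : Outer x → π x ⋖ x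
  π-⋖ {x} x-outer with <⇒∃⋖ (π< x-outer)
  ... | u , πx⋖u , u≤x with u ≟F x
  ...   | yes refl = πx⋖u
  ...   | no  u≢x  = ⊥-elim (π-no-gap x-outer πx⋖u (u≤x , u≢x))

  module _ (y∈Q : y ∈ Q) (b-new : NewAtom b) where

    private
      b∈S : b ∈ S
      b∈S = proj₁ b-new
      b∉Q : b ∉ Q
      b∉Q = proj₁ (proj₂ b-new)
      b-atom : Atom b
      b-atom = proj₂ (proj₂ b-new)

    minUB₂-unique : ∀ {z z′} → MinUB₂ S b y z → MinUB₂ S b y z′ → z ≡ z′
    minUB₂-unique z-min z′-min with TM1 y b y∈Q b∈S b-atom b∉Q
    ... | _ , _ , unique = trans (unique _ z-min) (sym (unique _ z′-min))

    minUB₂-least : MinUB₂ S b y z → w ∈ S → b ≤ w → y ≤ w → z ≤ w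
    minUB₂-least {z} {w} z-min w∈S b≤w y≤w with join w b y b≤w y≤w
    ... | j , j≤w , b≤j , y≤j , j-least = subst (_≤ w) (minUB₂-unique j-min z-min) j≤w
      where
      j-min : MinUB₂ S b y j
      j-min = (S-down _ _ w∈S j≤w , b≤j , y≤j)
            , λ v _ b≤v y≤v v≤j → antisym v≤j (j-least v (≤-trans v≤j j≤w) b≤v y≤v)

    minUB₂-⋖ : MinUB₂ S b y z → y ⋖ z
    minUB₂-⋖ {z} ((z∈S , b≤z , y≤z) , minimal) =
      geom⇐ z z y b ≤-refl y≤z b≤z b-atom (λ b≤y → b∉Q (Q-down _ _ y∈Q b≤y))
        (≤-refl , y≤z , b≤z , λ w w≤z y≤w b≤w → ≤-reflexive (sym (minimal w (S-down _ _ z∈S w≤z) b≤w y≤w w≤z)))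

    minUB₂-outer : MinUB₂ S b y z → Outer z
    minUB₂-outer ((z∈S , b≤z , _) , _) = z∈S , λ z∈Q → b∉Q (Q-down _ _ z∈Q b≤z)

    π-minUB₂ : MinUB₂ S b y z → π z ≡ y
    π-minUB₂ {z} z-min with π z ≟F y
    ... | yes πz≡y = πz≡y
    ... | no  πz≢y = ⊥-elim (proj₂ z-outer (subst (_∈ Q) πz≡z (π-∈ (proj₁ z-outer))))
      where
      z-outer : Outer z
      z-outer = minUB₂-outer z-min
      πz≡z : π z ≡ z
      πz≡z = ⋖-≤-≡ (minUB₂-⋖ z-min) (π-greatest y∈Q (proj₂ (proj₂ (proj₁ z-min))) , πz≢y ∘ sym) π-≤

  minUB₂-π : Outer x → NewAtom b → b ≤ x → MinUB₂ S b (π x) x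
  minUB₂-π {x} {b} x-outer@(x∈S , _) b-new@(b∈S , b∉Q , b-atom) b≤x
    with TM1 (π x) b (π-∈ x∈S) b∈S b-atom b∉Q
  ... | z , z-min , _ = subst (MinUB₂ S b (π x)) z≡x z-min
    where
    z≡x : z ≡ x
    z≡x = ⋖-≤-≡ (π-⋖ x-outer) (proj₁ (minUB₂-⋖ (π-∈ x∈S) b-new z-min))
            (minUB₂-least (π-∈ x∈S) b-new z-min x∈S b≤x π-≤)

  MinUB₂? : ∀ b y z → Dec (MinUB₂ S b y z)
  MinUB₂? b y z = ((z ∈? S) ×-dec (b ≤? z) ×-dec (y ≤? z))
    ×-dec all? (λ w → (w ∈? S) →-dec (b ≤? w) →-dec (y ≤? w) →-dec (w ≤? z) →-dec (w ≟F z))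

  fibre-⇔ : (Outer x × (NewAtom b × b ≤ x) × y ≡ π x) ⇔ ((NewAtom b × y ∈ Q) × MinUB₂ S b y x)
  fibre-⇔ {x} {b} {y} = mk⇔ to from
    where
    to : Outer x × (NewAtom b × b ≤ x) × y ≡ π x → (NewAtom b × y ∈ Q) × MinUB₂ S b y x
    to (x-outer , (b-new , b≤x) , refl) = (b-new , π-∈ (proj₁ x-outer)) , minUB₂-π x-outer b-new b≤x
    from : (NewAtom b × y ∈ Q) × MinUB₂ S b y x → Outer x × (NewAtom b × b ≤ x) × y ≡ π x
    from ((b-new , y∈Q) , x-min) =
      minUB₂-outer y∈Q b-new x-min , (b-new , proj₁ (proj₂ (proj₁ x-min))) , sym (π-minUB₂ y∈Q b-new x-min)

  fibre-term : ∀ x b y (v : ℤ) →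
    ⟦ Outer? x ⟧ ⟦ NewAtom? b ×-dec b ≤? x ⟧ ⟦ y ≟F π x ⟧ v ≡ ⟦ NewAtom? b ×-dec y ∈? Q ⟧ ⟦ MinUB₂? b y x ⟧ v
  fibre-term x b y v = begin
    ⟦ Outer? x ⟧ ⟦ NewAtom? b ×-dec b ≤? x ⟧ ⟦ y ≟F π x ⟧ v
      ≡⟨ cong (⟦ Outer? x ⟧_) (⟦⟧-× (NewAtom? b ×-dec b ≤? x) (y ≟F π x) v) ⟩
    ⟦ Outer? x ⟧ ⟦ (NewAtom? b ×-dec b ≤? x) ×-dec y ≟F π x ⟧ v
      ≡⟨ ⟦⟧-× (Outer? x) ((NewAtom? b ×-dec b ≤? x) ×-dec y ≟F π x) v ⟩
    ⟦ Outer? x ×-dec (NewAtom? b ×-dec b ≤? x) ×-dec y ≟F π x ⟧ v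
      ≡⟨ ⟦⟧-⇔ (Outer? x ×-dec (NewAtom? b ×-dec b ≤? x) ×-dec y ≟F π x)
              ((NewAtom? b ×-dec y ∈? Q) ×-dec MinUB₂? b y x) fibre-⇔ ⟩
    ⟦ (NewAtom? b ×-dec y ∈? Q) ×-dec MinUB₂? b y x ⟧ v
      ≡⟨ ⟦⟧-× (NewAtom? b ×-dec y ∈? Q) (MinUB₂? b y x) v ⟨
    ⟦ NewAtom? b ×-dec y ∈? Q ⟧ ⟦ MinUB₂? b y x ⟧ v ∎
    where
    open ≡-Reasoning

  sum-outer-newAtom : (F : El → El → ℤ) →
    sum (λ x → ⟦ Outer? x ⟧ sum (λ b → ⟦ NewAtom? b ×-dec b ≤? x ⟧ F b (π x)))
      ≡ sum (λ b → ⟦ NewAtom? b ⟧ sum (λ y → ⟦ y ∈? Q ⟧ F b y))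
  sum-outer-newAtom F = begin
    sum (λ x → ⟦ Outer? x ⟧ sum (λ b → ⟦ NewAtom? b ×-dec b ≤? x ⟧ F b (π x)))
      ≡⟨ sum-cong-≗ (λ x → trans (⟦⟧-sum (Outer? x) (λ b → ⟦ NewAtom? b ×-dec b ≤? x ⟧ F b (π x))) (sum-cong-≗ (expand x))) ⟩
    sum (λ x → sum (λ b → sum (λ y → ⟦ Outer? x ⟧ ⟦ NewAtom? b ×-dec b ≤? x ⟧ ⟦ y ≟F π x ⟧ F b y)))
      ≡⟨ sum-cong-≗ (λ x → sum-cong-≗ λ b → sum-cong-≗ λ y → fibre-term x b y (F b y)) ⟩
    sum (λ x → sum (λ b → sum (λ y → ⟦ NewAtom? b ×-dec y ∈? Q ⟧ ⟦ MinUB₂? b y x ⟧ F b y)))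
      ≡⟨ ∑-comm (λ x b → sum (λ y → ⟦ NewAtom? b ×-dec y ∈? Q ⟧ ⟦ MinUB₂? b y x ⟧ F b y)) ⟩
    sum (λ b → sum (λ x → sum (λ y → ⟦ NewAtom? b ×-dec y ∈? Q ⟧ ⟦ MinUB₂? b y x ⟧ F b y)))
      ≡⟨ sum-cong-≗ (λ b → ∑-comm (λ x y → ⟦ NewAtom? b ×-dec y ∈? Q ⟧ ⟦ MinUB₂? b y x ⟧ F b y)) ⟩
    sum (λ b → sum (λ y → sum (λ x → ⟦ NewAtom? b ×-dec y ∈? Q ⟧ ⟦ MinUB₂? b y x ⟧ F b y)))
      ≡⟨ sum-cong-≗ (λ b → sum-cong-≗ (contract b)) ⟩
    sum (λ b → sum (λ y → ⟦ NewAtom? b ×-dec y ∈? Q ⟧ F b y))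
      ≡⟨ sum-cong-≗ (λ b → trans (⟦⟧-sum (NewAtom? b) (λ y → ⟦ y ∈? Q ⟧ F b y)) (sum-cong-≗ λ y → ⟦⟧-× (NewAtom? b) (y ∈? Q) (F b y))) ⟨
    sum (λ b → ⟦ NewAtom? b ⟧ sum (λ y → ⟦ y ∈? Q ⟧ F b y)) ∎
    where
    open ≡-Reasoning

    expand : ∀ x b → ⟦ Outer? x ⟧ ⟦ NewAtom? b ×-dec b ≤? x ⟧ F b (π x)
                       ≡ sum (λ y → ⟦ Outer? x ⟧ ⟦ NewAtom? b ×-dec b ≤? x ⟧ ⟦ y ≟F π x ⟧ F b y)
    expand x b = begin
      ⟦ Outer? x ⟧ ⟦ NewAtom? b ×-dec b ≤? x ⟧ F b (π x)
        ≡⟨ cong (λ v → ⟦ Outer? x ⟧ ⟦ NewAtom? b ×-dec b ≤? x ⟧ v)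
                (sum-⟦⟧-unique (_≟F π x) (F b) refl (λ _ y≡πx → y≡πx)) ⟨
      ⟦ Outer? x ⟧ ⟦ NewAtom? b ×-dec b ≤? x ⟧ sum (λ y → ⟦ y ≟F π x ⟧ F b y)
        ≡⟨ cong (⟦ Outer? x ⟧_) (⟦⟧-sum (NewAtom? b ×-dec b ≤? x) (λ y → ⟦ y ≟F π x ⟧ F b y)) ⟩
      ⟦ Outer? x ⟧ sum (λ y → ⟦ NewAtom? b ×-dec b ≤? x ⟧ ⟦ y ≟F π x ⟧ F b y)
        ≡⟨ ⟦⟧-sum (Outer? x) (λ y → ⟦ NewAtom? b ×-dec b ≤? x ⟧ ⟦ y ≟F π x ⟧ F b y) ⟩
      sum (λ y → ⟦ Outer? x ⟧ ⟦ NewAtom? b ×-dec b ≤? x ⟧ ⟦ y ≟F π x ⟧ F b y) ∎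

    contract : ∀ b y → sum (λ x → ⟦ NewAtom? b ×-dec y ∈? Q ⟧ ⟦ MinUB₂? b y x ⟧ F b y)
                         ≡ ⟦ NewAtom? b ×-dec y ∈? Q ⟧ F b y
    contract b y = trans (sym (⟦⟧-sum (NewAtom? b ×-dec y ∈? Q) (λ x → ⟦ MinUB₂? b y x ⟧ F b y))) (⟦⟧-cong (NewAtom? b ×-dec y ∈? Q) unique)
      where
      unique : NewAtom b × y ∈ Q → sum (λ x → ⟦ MinUB₂? b y x ⟧ F b y) ≡ F b y
      unique (b-new@(b∈S , b∉Q , b-atom) , y∈Q) with TM1 y b y∈Q b∈S b-atom b∉Q
      ... | z , z-min , _ = sum-⟦⟧-unique (MinUB₂? b y) (λ _ → F b y) z-min
                              (λ x x-min → minUB₂-unique y∈Q b-new x-min z-min)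

  <⇔π< : Outer x → Outer z → NewAtom b → b ≤ z → z < x ⇔ (b ≤ x × π z < π x)
  <⇔π< {x} {z} {b} x-outer@(x∈S , _) z-outer b-new b≤z = mk⇔ to from
    where
    z-min : MinUB₂ S b (π z) z
    z-min = minUB₂-π z-outer b-new b≤z
    to : z < x → b ≤ x × π z < π x
    to (z≤x , z≢x) = b≤x , π-mono x∈S z≤x , λ πz≡πx →
      z≢x (minUB₂-unique (π-∈ x∈S) b-new (subst (λ y → MinUB₂ S b y z) πz≡πx z-min) (minUB₂-π x-outer b-new b≤x))
      where
      b≤x : b ≤ x
      b≤x = ≤-trans b≤z z≤x
    from : b ≤ x × π z < π x → z < x
    from (b≤x , πz<πx) = minUB₂-least (π-∈ (proj₁ z-outer)) b-new z-min x∈S b≤x (≤-trans (proj₁ πz<πx) π-≤)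
                       , λ { refl → proj₂ πz<πx refl }

  sum-<-split : Outer x → sum (λ z → ⟦ z <? x ⟧ μ S z)
                            ≡ sum (λ z → ⟦ z ≤? π x ⟧ μ S z) + sum (λ z → ⟦ Outer? z ×-dec z <? x ⟧ μ S z)
  sum-<-split {x} x-outer@(x∈S , _) =
    trans (sum-cong-≗ split) (∑-distrib-+ (λ z → ⟦ z ≤? π x ⟧ μ S z) (λ z → ⟦ Outer? z ×-dec z <? x ⟧ μ S z))
    where
    split : ∀ z → ⟦ z <? x ⟧ μ S z ≡ ⟦ z ≤? π x ⟧ μ S z + ⟦ Outer? z ×-dec z <? x ⟧ μ S z
    split z = ⟦⟧-⊎ (z <? x) (z ≤? π x) (Outer? z ×-dec z <? x) to from
      (λ z≤πx (z-outer , _) → proj₂ z-outer (Q-down _ _ (π-∈ x∈S) z≤πx))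
      where
      to : z < x → z ≤ π x ⊎ Outer z × z < x
      to z<x with z ∈? Q
      ... | yes z∈Q = inj₁ (π-greatest z∈Q (proj₁ z<x))
      ... | no  z∉Q = inj₂ ((S-down _ _ x∈S (proj₁ z<x) , z∉Q) , z<x)
      from : z ≤ π x ⊎ Outer z × z < x → z < x
      from (inj₁ z≤πx)     = ≤-<-trans z≤πx (π< x-outer)
      from (inj₂ (_ , z<x)) = z<x

  MöbiusStep : El → Set
  MöbiusStep x = μ S x ≡ - sum (λ b → ⟦ NewAtom? b ×-dec b ≤? x ⟧ μ S (π x))

  μ-below : El → ℤ
  μ-below y = sum (λ w → ⟦ w <? y ⟧ μ S w)

  sum-outer-below : Outer x → (∀ {z} → z < x → Outer z → MöbiusStep z) →
    sum (λ z → ⟦ Outer? z ×-dec z <? x ⟧ μ S z) ≡ - sum (λ b → ⟦ NewAtom? b ×-dec b ≤? x ⟧ μ-below (π x))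
  sum-outer-below {x} x-outer@(x∈S , _) step-below = begin
    sum (λ z → ⟦ Outer? z ×-dec z <? x ⟧ μ S z)
      ≡⟨ sum-cong-≗ (λ z → trans (sym (⟦⟧-× (Outer? z) (z <? x) (μ S z))) (⟦⟧-cong (Outer? z) (below-term z))) ⟩
    sum (λ z → ⟦ Outer? z ⟧ (- sum (λ b → ⟦ NewAtom? b ×-dec b ≤? z ⟧ g b (π z))))
      ≡⟨ sum-cong-≗ (λ z → ⟦⟧-neg (Outer? z) (sum (λ b → ⟦ NewAtom? b ×-dec b ≤? z ⟧ g b (π z)))) ⟩
    sum (λ z → - ⟦ Outer? z ⟧ sum (λ b → ⟦ NewAtom? b ×-dec b ≤? z ⟧ g b (π z)))
      ≡⟨ sum-neg (λ z → ⟦ Outer? z ⟧ sum (λ b → ⟦ NewAtom? b ×-dec b ≤? z ⟧ g b (π z))) ⟩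
    - sum (λ z → ⟦ Outer? z ⟧ sum (λ b → ⟦ NewAtom? b ×-dec b ≤? z ⟧ g b (π z)))
      ≡⟨ cong -_ (sum-outer-newAtom g) ⟩
    - sum (λ b → ⟦ NewAtom? b ⟧ sum (λ w → ⟦ w ∈? Q ⟧ g b w))
      ≡⟨ cong -_ (sum-cong-≗ newAtom-term) ⟩
    - sum (λ b → ⟦ NewAtom? b ×-dec b ≤? x ⟧ μ-below (π x)) ∎
    where
    open ≡-Reasoning

    g : El → El → ℤ
    g b w = ⟦ b ≤? x ×-dec w <? π x ⟧ μ S w

    below-term : ∀ z → Outer z → ⟦ z <? x ⟧ μ S z ≡ - sum (λ b → ⟦ NewAtom? b ×-dec b ≤? z ⟧ g b (π z))
    below-term z z-outer with z <? x
    ... | yes z<x = trans (step-below z<x z-outer) (cong -_ (sum-cong-≗ λ b →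
            ⟦⟧-cong (NewAtom? b ×-dec b ≤? z) λ (b-new , b≤z) →
              sym (⟦⟧-yes (b ≤? x ×-dec π z <? π x) (Equivalence.to (<⇔π< x-outer z-outer b-new b≤z) z<x))))
    ... | no  z≮x = sym (cong -_ (sum-zero λ b →
            trans (⟦⟧-cong (NewAtom? b ×-dec b ≤? z) λ (b-new , b≤z) →
                     ⟦⟧-no (b ≤? x ×-dec π z <? π x) (z≮x ∘ Equivalence.from (<⇔π< x-outer z-outer b-new b≤z)))
                  (⟦⟧-zero (NewAtom? b ×-dec b ≤? z))))

    newAtom-term : ∀ b → ⟦ NewAtom? b ⟧ sum (λ w → ⟦ w ∈? Q ⟧ g b w) ≡ ⟦ NewAtom? b ×-dec b ≤? x ⟧ μ-below (π x)
    newAtom-term b = trans (cong (⟦ NewAtom? b ⟧_) (trans (sum-cong-≗ restrict)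
                             (sym (⟦⟧-sum (b ≤? x) (λ w → ⟦ w <? π x ⟧ μ S w)))))
                           (⟦⟧-× (NewAtom? b) (b ≤? x) (μ-below (π x)))
      where
      restrict : ∀ w → ⟦ w ∈? Q ⟧ g b w ≡ ⟦ b ≤? x ⟧ ⟦ w <? π x ⟧ μ S w
      restrict w = trans (⟦⟧-× (w ∈? Q) (b ≤? x ×-dec w <? π x) (μ S w))
        (trans (⟦⟧-⇔ ((w ∈? Q) ×-dec (b ≤? x ×-dec w <? π x)) (b ≤? x ×-dec w <? π x)
                 (mk⇔ proj₂ λ (b≤x , w<πx) → Q-down _ _ (π-∈ x∈S) (proj₁ w<πx) , b≤x , w<πx))
               (sym (⟦⟧-× (b ≤? x) (w <? π x) (μ S w))))

  μ-step-rearrange : Outer x →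
    - ((μ-below (π x) + μ S (π x)) + - sum (λ b → ⟦ NewAtom? b ×-dec b ≤? x ⟧ μ-below (π x)))
      ≡ - sum (λ b → ⟦ NewAtom? b ×-dec b ≤? x ⟧ μ S (π x))
  μ-step-rearrange {x} x-outer@(x∈S , x∉Q) =
    trans (cong (λ s → - ((μ-below (π x) + μ S (π x)) + - s)) (sum-⟦⟧-const N≤? (μ-below (π x))))
          (trans (rearrange (π x ≟F ⊥̂)) (cong -_ (sym (sum-⟦⟧-const N≤? (μ S (π x))))))
    where
    N≤? : U.Decidable (λ b → NewAtom b × b ≤ x)
    N≤? b = NewAtom? b ×-dec b ≤? x

    c : ℤ
    c = sum (λ b → ⟦ N≤? b ⟧ (+ 1))

    rearrange : Dec (π x ≡ ⊥̂) → - ((μ-below (π x) + μ S (π x)) + - (c * μ-below (π x))) ≡ - (c * μ S (π x))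
    rearrange (no πx≢⊥̂) = trans (cong (λ l → - ((l + μ S (π x)) + - (c * l))) μ-below≡-μ) (cancel (μ S (π x)) c)
      where
      μ-below≡-μ : μ-below (π x) ≡ - μ S (π x)
      μ-below≡-μ = sym (trans (cong -_ (μ-recurrence-down S-down (Q⊆S (π-∈ x∈S)) πx≢⊥̂)) (ℤ.neg-involutive _))
      cancel : ∀ m c → - ((- m + m) + - (c * - m)) ≡ - (c * m)
      cancel = solve-∀
    rearrange (yes πx≡⊥̂) = trans (cong (λ c → - ((μ-below (π x) + μ S (π x)) + - (c * μ-below (π x)))) c≡1)
                                 (trans (cancel (μ-below (π x)) (μ S (π x))) (cong (λ c → - (c * μ S (π x))) (sym c≡1)))
      where
      x-atom : Atom x
      x-atom = subst (_⋖ x) πx≡⊥̂ (π-⋖ x-outer)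
      c≡1 : c ≡ + 1
      c≡1 = sum-⟦⟧-unique N≤? (λ _ → + 1) ((x∈S , x∉Q , x-atom) , ≤-refl)
              (λ b ((_ , _ , b-atom) , b≤x) → atom-≤-≡ b-atom x-atom b≤x)
      cancel : ∀ l m → - ((l + m) + - (+ 1 * l)) ≡ - (+ 1 * m)
      cancel = solve-∀

  μ-step : Outer x → MöbiusStep x
  μ-step = go (<-wellFounded _)
    where
    go : Acc _<_ x → Outer x → MöbiusStep x
    go {x} (acc below) x-outer@(x∈S , _) = begin
      μ S x
        ≡⟨ μ-recurrence-down S-down x∈S x≢⊥̂ ⟩
      - sum (λ z → ⟦ z <? x ⟧ μ S z)
        ≡⟨ cong -_ (sum-<-split x-outer) ⟩
      - (sum (λ z → ⟦ z ≤? π x ⟧ μ S z) + sum (λ z → ⟦ Outer? z ×-dec z <? x ⟧ μ S z))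
        ≡⟨ cong₂ (λ u v → - (u + v)) (sum-≤-split (μ S) (π x)) (sum-outer-below x-outer (go ∘ below)) ⟩
      - ((μ-below (π x) + μ S (π x)) + - sum (λ b → ⟦ NewAtom? b ×-dec b ≤? x ⟧ μ-below (π x)))
        ≡⟨ μ-step-rearrange x-outer ⟩
      - sum (λ b → ⟦ NewAtom? b ×-dec b ≤? x ⟧ μ S (π x)) ∎
      where
      open ≡-Reasoning
      x≢⊥̂ : x ≢ ⊥̂
      x≢⊥̂ x≡⊥̂ = proj₂ (π< x-outer) (antisym π-≤ (subst (_≤ π x) (sym x≡⊥̂) (⊥̂-min _)))

  module _ (t : ℤ) where

    termS termQ : El → ℤ
    termS x = μ S x * t ^ (rkOf S ∸ rk x)
    termQ y = μ Q y * t ^ (rkOf Q ∸ rk y)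

    χQ≡sum : χ Q t ≡ sum (λ y → ⟦ y ∈? Q ⟧ termQ y)
    χQ≡sum = sumEl≡sum _

    termS-Q : x ∈ Q → termS x ≡ termQ x * t
    termS-Q {x} x∈Q = begin
      μ S x * t ^ (rkOf S ∸ rk x)        ≡⟨ cong₂ (λ m e → m * t ^ e) (μ-ideal Q⊆S Q-down x∈Q) exponent ⟩
      μ Q x * (t * t ^ (rkOf Q ∸ rk x))  ≡⟨ rotate (μ Q x) (t ^ (rkOf Q ∸ rk x)) t ⟩
      termQ x * t                        ∎
      where
      open ≡-Reasoning
      exponent : rkOf S ∸ rk x ≡ suc (rkOf Q ∸ rk x)
      exponent = trans (cong (_∸ rk x) (sym rk-step)) (ℕₚ.+-∸-assoc 1 (rk≤rkOf x∈Q))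
      rotate : ∀ m u t → m * (t * u) ≡ (m * u) * t
      rotate = solve-∀

    termS-outer : Outer x → termS x ≡ - sum (λ b → ⟦ NewAtom? b ×-dec b ≤? x ⟧ termQ (π x))
    termS-outer {x} x-outer = begin
      μ S x * t ^ (rkOf S ∸ rk x)
        ≡⟨ cong₂ (λ m e → m * t ^ e) (μ-step x-outer) exponent ⟩
      - sum (λ b → ⟦ NewAtom? b ×-dec b ≤? x ⟧ μ S (π x)) * t ^ e
        ≡⟨ ℤ.neg-distribˡ-* (sum (λ b → ⟦ NewAtom? b ×-dec b ≤? x ⟧ μ S (π x))) (t ^ e) ⟨
      - (sum (λ b → ⟦ NewAtom? b ×-dec b ≤? x ⟧ μ S (π x)) * t ^ e)
        ≡⟨ cong -_ (sum-*ʳ (λ b → ⟦ NewAtom? b ×-dec b ≤? x ⟧ μ S (π x)) (t ^ e)) ⟨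
      - sum (λ b → (⟦ NewAtom? b ×-dec b ≤? x ⟧ μ S (π x)) * t ^ e)
        ≡⟨ cong -_ (sum-cong-≗ λ b → ⟦⟧-*ʳ (NewAtom? b ×-dec b ≤? x) (μ S (π x)) (t ^ e)) ⟩
      - sum (λ b → ⟦ NewAtom? b ×-dec b ≤? x ⟧ (μ S (π x) * t ^ e))
        ≡⟨ cong -_ (sum-cong-≗ λ b → cong (λ m → ⟦ NewAtom? b ×-dec b ≤? x ⟧ (m * t ^ e))
                                           (μ-ideal Q⊆S Q-down (π-∈ (proj₁ x-outer)))) ⟩
      - sum (λ b → ⟦ NewAtom? b ×-dec b ≤? x ⟧ termQ (π x)) ∎
      where
      open ≡-Reasoning
      e : ℕ
      e = rkOf Q ∸ rk (π x)
      exponent : rkOf S ∸ rk x ≡ e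
      exponent = cong₂ _∸_ (sym rk-step) (rk-⋖ (π x) x (π-⋖ x-outer))

    sum-Q-termS : sum (λ x → ⟦ x ∈? Q ⟧ termS x) ≡ χ Q t * t
    sum-Q-termS = begin
      sum (λ x → ⟦ x ∈? Q ⟧ termS x)       ≡⟨ sum-cong-≗ (λ x → trans (⟦⟧-cong (x ∈? Q) termS-Q) (sym (⟦⟧-*ʳ (x ∈? Q) (termQ x) t))) ⟩
      sum (λ x → (⟦ x ∈? Q ⟧ termQ x) * t) ≡⟨ sum-*ʳ (λ x → ⟦ x ∈? Q ⟧ termQ x) t ⟩
      sum (λ x → ⟦ x ∈? Q ⟧ termQ x) * t   ≡⟨ cong (_* t) χQ≡sum ⟨
      χ Q t * t                            ∎
      where open ≡-Reasoning

    sum-outer-termS : sum (λ x → ⟦ Outer? x ⟧ termS x) ≡ - (+ newAtoms S Q * χ Q t)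
    sum-outer-termS = begin
      sum (λ x → ⟦ Outer? x ⟧ termS x)
        ≡⟨ sum-cong-≗ (λ x → trans (⟦⟧-cong (Outer? x) termS-outer)
                                   (⟦⟧-neg (Outer? x) (sum (λ b → ⟦ NewAtom? b ×-dec b ≤? x ⟧ termQ (π x))))) ⟩
      sum (λ x → - ⟦ Outer? x ⟧ sum (λ b → ⟦ NewAtom? b ×-dec b ≤? x ⟧ termQ (π x)))
        ≡⟨ sum-neg (λ x → ⟦ Outer? x ⟧ sum (λ b → ⟦ NewAtom? b ×-dec b ≤? x ⟧ termQ (π x))) ⟩
      - sum (λ x → ⟦ Outer? x ⟧ sum (λ b → ⟦ NewAtom? b ×-dec b ≤? x ⟧ termQ (π x)))
        ≡⟨ cong -_ (sum-outer-newAtom (λ _ → termQ)) ⟩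
      - sum (λ b → ⟦ NewAtom? b ⟧ sum (λ y → ⟦ y ∈? Q ⟧ termQ y))
        ≡⟨ cong -_ (sum-cong-≗ λ b → cong (⟦ NewAtom? b ⟧_) χQ≡sum) ⟨
      - sum (λ b → ⟦ NewAtom? b ⟧ χ Q t)
        ≡⟨ cong -_ (sum-⟦⟧-const NewAtom? (χ Q t)) ⟩
      - (sum (λ b → ⟦ NewAtom? b ⟧ (+ 1)) * χ Q t)
        ≡⟨ cong (λ a → - (a * χ Q t)) (length-filter-tabulate NewAtom? (λ b → b)) ⟨
      - (+ newAtoms S Q * χ Q t) ∎
      where open ≡-Reasoning

    χ-factor : χ S t ≡ χ Q t * (t - + newAtoms S Q)
    χ-factor = begin
      χ S t
        ≡⟨ sumEl≡sum _ ⟩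
      sum (λ x → ⟦ x ∈? S ⟧ termS x)
        ≡⟨ trans (sum-cong-≗ split) (∑-distrib-+ (λ x → ⟦ x ∈? Q ⟧ termS x) (λ x → ⟦ Outer? x ⟧ termS x)) ⟩
      sum (λ x → ⟦ x ∈? Q ⟧ termS x) + sum (λ x → ⟦ Outer? x ⟧ termS x)
        ≡⟨ cong₂ _+_ sum-Q-termS sum-outer-termS ⟩
      χ Q t * t + - (+ newAtoms S Q * χ Q t)
        ≡⟨ factor (χ Q t) t (+ newAtoms S Q) ⟩
      χ Q t * (t - + newAtoms S Q) ∎
      where
      open ≡-Reasoning
      split : ∀ x → ⟦ x ∈? S ⟧ termS x ≡ ⟦ x ∈? Q ⟧ termS x + ⟦ Outer? x ⟧ termS x
      split x = ⟦⟧-⊎ (x ∈? S) (x ∈? Q) (Outer? x) to from (λ x∈Q (_ , x∉Q) → x∉Q x∈Q)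
        where
        to : x ∈ S → x ∈ Q ⊎ Outer x
        to x∈S with x ∈? Q
        ... | yes x∈Q = inj₁ x∈Q
        ... | no  x∉Q = inj₂ (x∈S , x∉Q)
        from : x ∈ Q ⊎ Outer x → x ∈ S
        from (inj₁ x∈Q)     = Q⊆S x∈Q
        from (inj₂ x-outer) = proj₁ x-outer
      factor : ∀ c t a → c * t + - (a * c) ≡ c * (t - a)
      factor = solve-∀

module _ {P : FinPoset} (G : LocallyGeometric P) where
  open Poset P
  open LocallyGeometric G
  open LG G
  open FinPosetProperties P using (IsDownClosed)
  open LocallyGeometricProperties G

  χ-TM-factor : ∀ Q → IsTMIdeal Q → suc (rkOf Q) ≡ rkOf ⊤ → ∀ t → χ ⊤ t ≡ χ Q t * (t - + newAtoms ⊤ Q)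
  χ-TM-factor Q tm rk-step = TMIdealProperties.χ-factor G ⊤ Q (λ _ _ _ _ → ∈⊤) tm rk-step

  χ-TM-chain : ∀ n (Qs : ℕ → Subset card) → Qs 0 ≡ ⁅ ⊥̂ ⁆ → Qs n ≡ ⊤ →
    (∀ i → i ℕ.≤ n → rkOf (Qs i) ≡ i) → (∀ i → i ℕ.< n → IsTMIdealIn (Qs (suc i)) (Qs i)) →
    ∀ t → χ ⊤ t ≡ prodLin (λ i → newAtoms (Qs i) (Qs (ℕ.pred i))) n t
  χ-TM-chain n Qs Q₀≡⁅⊥̂⁆ Qₙ≡⊤ rk-Qs tm t = trans (cong (λ S → χ S t) (sym Qₙ≡⊤)) (go n ℕₚ.≤-refl)
    where
    go : ∀ k → k ℕ.≤ n → χ (Qs k) t ≡ prodLin (λ i → newAtoms (Qs i) (Qs (ℕ.pred i))) k t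
    go zero    _ = begin
      χ (Qs 0) t           ≡⟨ cong (λ S → χ S t) Q₀≡⁅⊥̂⁆ ⟩
      χ ⁅ ⊥̂ ⁆ t            ≡⟨ χ-⁅⊥̂⁆ t ⟩
      t ^ rkOf ⁅ ⊥̂ ⁆       ≡⟨ cong (λ S → t ^ rkOf S) Q₀≡⁅⊥̂⁆ ⟨
      t ^ rkOf (Qs 0)      ≡⟨ cong (t ^_) (rk-Qs 0 ℕ.z≤n) ⟩
      + 1                  ∎
      where open ≡-Reasoning
    go (suc k) k<n = trans (TMIdealProperties.χ-factor G (Qs (suc k)) (Qs k) down (tm k k<n) rk-step t)
                           (cong (λ c → c * (t - + newAtoms (Qs (suc k)) (Qs k))) (go k (ℕₚ.<⇒≤ k<n)))
      where
      rk-step : suc (rkOf (Qs k)) ≡ rkOf (Qs (suc k))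
      rk-step = trans (cong suc (rk-Qs k (ℕₚ.<⇒≤ k<n))) (sym (rk-Qs (suc k) k<n))
      down : IsDownClosed (Qs (suc k))
      down with ℕₚ.m≤n⇒m<n∨m≡n k<n
      ... | inj₁ k+1<n = proj₂ (IsTMIdealIn.ideal (tm (suc k) k+1<n))
      ... | inj₂ k+1≡n = λ x _ _ _ → subst (x ∈_) (sym (trans (cong Qs k+1≡n) Qₙ≡⊤)) ∈⊤

theorem5p10 : (P : FinPoset) (G : LocallyGeometric P) →
    let open Poset P using (card)
        open LocallyGeometric G
        open LG G
    in
    (∀ (Q : Subset card) → IsTMIdeal Q → suc (rkOf Q) ≡ rkOf ⊤ →
      ∀ (t : ℤ) → χ ⊤ t ≡ χ Q t * (t - + newAtoms ⊤ Q))
    ×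
    (∀ (n : ℕ) (Qs : ℕ → Subset card) →
      Qs 0 ≡ ⁅ ⊥̂ ⁆ → Qs n ≡ ⊤ →
      (∀ i → i ℕ.≤ n → rkOf (Qs i) ≡ i) →
      (∀ i → i ℕ.< n → IsTMIdealIn (Qs (suc i)) (Qs i)) →
      ∀ (t : ℤ) → χ ⊤ t ≡ prodLin (λ i → newAtoms (Qs i) (Qs (ℕ.pred i))) n t)
theorem5p10 P G = χ-TM-factor G , χ-TM-chain G
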